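{- Let $\{a_i\},\{b_i\},\{c_i\},\{d_i\}$ ($i\in\mathbb{Z}$) be complex sequences and $m,n\ge 0$ integers such that $a_j\ne c_j$, $a_j\neq d_j$, $b_j\neq c_j$, $b_j\neq d_j$ for all $-n\le j\le m$. Then $$\sum_{k=-n}^{m}(a_k-b_k)(c_k-d_k)\frac{\prod_{j=1}^{k-1}(a_j-c_j)}{\prod_{j=1}^{k}(a_j-d_j)}\frac{\prod_{j=1}^{k-1}(b_j-d_j)}{\prod_{j=1}^{k}(b_j-c_j)} =\frac{\prod_{j=1}^{m}(a_j-c_j)}{\prod_{j=1}^{m}(a_j-d_j)}\frac{\prod_{j=1}^{m}(b_j-d_j)}{\prod_{j=1}^{m}(b_j-c_j)}-\frac{\prod_{j=-n}^{0}(a_j-d_j)}{\prod_{j=-n}^{0}(a_j-c_j)}\frac{\prod_{j=-n}^{0}(b_j-c_j)}{\prod_{j=-n}^{0}(b_j-d_j)}.$$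
   Context: Products over integer ranges use the convention: for integers $k,m$, $$\prod_{j=k}^{m}A_j=\begin{cases}A_kA_{k+1}\cdots A_m,& m\ge k,\\ 1,& m=k-1,\\ (A_{m+1}A_{m+2}\cdots A_{k-1})^{ -1},& m\le k-2.\end{cases}$$ -}

module Defs where

open import Level using (Level; _⊔_) renaming (suc to lsuc)
open import Algebra.Bundles using (CommutativeRing)
open import Data.Nat using (ℕ; zero; suc)
open import Data.Integer using (ℤ; +_; -[1+_])
import Data.Integer as Z
open import Relation.Nullary using (¬_)

record Field (c ℓ : Level) : Set (lsuc (c ⊔ ℓ)) where
  field
    commutativeRing : CommutativeRing c ℓ
  open CommutativeRing commutativeRing public
  field
    _⁻¹      : Carrier → Carrier
    ⁻¹-cong  : ∀ {x y} → x ≈ y → x ⁻¹ ≈ y ⁻¹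
    inverseʳ : ∀ x → ¬ (x ≈ 0#) → x * (x ⁻¹) ≈ 1#
    0≉1      : ¬ (0# ≈ 1#)

  infixl 7 _/_
  _/_ : Carrier → Carrier → Carrier
  x / y = x * (y ⁻¹)

  prodUp : (ℤ → Carrier) → ℤ → ℕ → Carrier
  prodUp A k zero    = 1#
  prodUp A k (suc l) = A k * prodUp A (k Z.+ + 1) l

  -- ∏_{j=k}^{m} A j with the convention of the paper:
  --   m ≥ k     : A k ⋯ A m
  --   m = k - 1 : 1
  --   m ≤ k - 2 : (A (m+1) ⋯ A (k-1))⁻¹
  prod : (ℤ → Carrier) → ℤ → ℤ → Carrier
  prod A k m with m Z.- k Z.+ + 1
  ... | + len      = prodUp A k len
  ... | -[1+ len ] = (prodUp A (m Z.+ + 1) (suc len)) ⁻¹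

  sumUp : (ℤ → Carrier) → ℤ → ℕ → Carrier
  sumUp f k zero    = 0#
  sumUp f k (suc l) = f k + sumUp f (k Z.+ + 1) l

-- Write P_A(k) for ∏_{j=1}^{k} A_j. With the paper's convention for empty and reversed
-- ranges, P_A(k) = P_A(k-1) A_k holds for every integer k, not only for k ≥ 1, as long as
-- the factors it involves are nonzero; and P_A(-n-1) = (∏_{j=-n}^{0} A_j)⁻¹. Put
-- R(k) = (P_{a-c}(k) / P_{a-d}(k)) (P_{b-d}(k) / P_{b-c}(k)). The k-th summand is
-- R(k) - R(k-1), because (a-c)(b-d) - (a-d)(b-c) = (a-b)(c-d) (Euler's four-point identity).
-- The sum therefore telescopes to R(m) - R(-n-1), and R(-n-1) is the subtracted term.

module Submission where

open import Defs
open import Algebra.Bundles using (CommutativeRing)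
open import Data.Nat using (ℕ; zero; suc; z≤n; s≤s)
import Data.Nat as ℕ
import Data.Nat.Properties as ℕ
open import Data.Integer using (ℤ; +_; -[1+_]; +≤+)
import Data.Integer as Z
import Data.Integer.Properties as ZP
open import Data.Product using (_×_; proj₁; proj₂)
open import Relation.Nullary using (¬_)
open import Relation.Binary.PropositionalEquality as ≡ using (_≡_)
import Relation.Binary.Reasoning.Setoid as SetoidReasoning
open import Data.Integer.Solver using (module +-*-Solver)

i-1+1≡i : ∀ i → i Z.- + 1 Z.+ + 1 ≡ i
i-1+1≡i i = ≡.trans (ZP.+-assoc i -[1+ 0 ] (+ 1)) (ZP.+-identityʳ i)

i+1-1≡i : ∀ i → i Z.+ + 1 Z.- + 1 ≡ i
i+1-1≡i i = ≡.trans (ZP.+-assoc i (+ 1) -[1+ 0 ]) (ZP.+-identityʳ i)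

-[1+l]+1≡-l : ∀ l → -[1+ l ] Z.+ + 1 ≡ Z.- (+ l)
-[1+l]+1≡-l zero    = ≡.refl
-[1+l]+1≡-l (suc l) = ≡.refl

-l-1≡-[1+l] : ∀ l → Z.- (+ l) Z.- + 1 ≡ -[1+ l ]
-l-1≡-[1+l] zero    = ≡.refl
-l-1≡-[1+l] (suc l) = ≡.cong (λ t → -[1+ suc t ]) (ℕ.+-identityʳ l)

0-[-l]+1≡1+l : ∀ l → + 0 Z.- Z.- (+ l) Z.+ + 1 ≡ + suc l
0-[-l]+1≡1+l zero    = ≡.refl
0-[-l]+1≡1+l (suc l) = ≡.cong (λ t → + suc t) (ℕ.+-comm l 1)

-n+[n+m]≡m : ∀ n m → Z.- (+ n) Z.+ + (n ℕ.+ m) ≡ + m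
-n+[n+m]≡m n m = solve 2 (λ n m → :- n :+ (n :+ m) := m) ≡.refl (+ n) (+ m)
  where open +-*-Solver

-n+[n+m+1]-1≡m : ∀ n m → Z.- (+ n) Z.+ + (n ℕ.+ m ℕ.+ 1) Z.- + 1 ≡ + m
-n+[n+m+1]-1≡m n m = solve 2 (λ n m → :- n :+ (n :+ m :+ con (+ 1)) :- con (+ 1) := m) ≡.refl (+ n) (+ m)
  where open +-*-Solver

-n≤-[1+i]⇒i<n : ∀ {n i} → Z.- (+ n) Z.≤ -[1+ i ] → i ℕ.< n
-n≤-[1+i]⇒i<n lo with ZP.neg-cancel-≤ lo
... | +≤+ i<n = i<n

module CommutativeRingProperties {c ℓ} (R : CommutativeRing c ℓ) where
  open CommutativeRing R
  open import Algebra.Properties.Ring ring using (x[y-z]≈xy-xz; [y-z]x≈yx-zx; ⁻¹-anti-homo‿-)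
  open import Relation.Binary.Reasoning.Setoid setoid

  [x-y]+[y-z]≈x-z : ∀ x y z → (x - y) + (y - z) ≈ x - z
  [x-y]+[y-z]≈x-z x y z = begin
    (x - y) + (y - z)    ≈⟨ +-assoc x (- y) (y - z) ⟩
    x + (- y + (y - z))  ≈⟨ +-congˡ (+-assoc (- y) y (- z)) ⟨
    x + ((- y + y) - z)  ≈⟨ +-congˡ (+-congʳ (-‿inverseˡ y)) ⟩
    x + (0# - z)         ≈⟨ +-congˡ (+-identityˡ (- z)) ⟩
    x - z                ∎

  [x-z]-[y-z]≈x-y : ∀ x y z → (x - z) - (y - z) ≈ x - y
  [x-z]-[y-z]≈x-y x y z = trans (+-congˡ (⁻¹-anti-homo‿- y z)) ([x-y]+[y-z]≈x-z x z y)

  [z-x]-[z-y]≈y-x : ∀ x y z → (z - x) - (z - y) ≈ y - x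
  [z-x]-[z-y]≈y-x x y z = begin
    (z - x) - (z - y)    ≈⟨ +-congˡ (⁻¹-anti-homo‿- z y) ⟩
    (z - x) + (y - z)    ≈⟨ +-comm (z - x) (y - z) ⟩
    (y - z) + (z - x)    ≈⟨ [x-y]+[y-z]≈x-z y z x ⟩
    y - x                ∎

  [a-c][b-d]-[a-d][b-c]≈[a-b][c-d] : ∀ a b c d →
    (a - c) * (b - d) - (a - d) * (b - c) ≈ (a - b) * (c - d)
  [a-c][b-d]-[a-d][b-c]≈[a-b][c-d] a b c d = begin
    α * γ - β * δ                      ≈⟨ [x-z]-[y-z]≈x-y (α * γ) (β * δ) (α * δ) ⟨
    (α * γ - α * δ) - (β * δ - α * δ)
      ≈⟨ +-cong (x[y-z]≈xy-xz α γ δ) (-‿cong ([y-z]x≈yx-zx δ β α)) ⟨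
    α * (γ - δ) - (β - α) * δ
      ≈⟨ +-cong (*-congˡ ([z-x]-[z-y]≈y-x d c b)) (-‿cong (*-congʳ ([z-x]-[z-y]≈y-x d c a))) ⟩
    α * (c - d) - (c - d) * δ          ≈⟨ +-congˡ (-‿cong (*-comm (c - d) δ)) ⟩
    α * (c - d) - δ * (c - d)          ≈⟨ [y-z]x≈yx-zx (c - d) α δ ⟨
    (α - δ) * (c - d)                  ≈⟨ *-congʳ ([x-z]-[y-z]≈x-y a b c) ⟩
    (a - b) * (c - d)                  ∎
    where
    α = a - c
    β = a - d
    γ = b - d
    δ = b - c

module FieldProperties {c ℓ} (F : Field c ℓ) where
  open Field F
  open import Algebra.Properties.Ring ring using ([y-z]x≈yx-zx; x∙y⁻¹≈ε⇒x≈y)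
  open import Algebra.Solver.CommutativeMonoid *-commutativeMonoid using (solve; _⊜_; _⊕_)
  open import Relation.Binary.Reasoning.Setoid setoid
  open CommutativeRingProperties commutativeRing

  1≉0 : 1# ≉ 0#
  1≉0 1≈0 = 0≉1 (sym 1≈0)

  inverseˡ : ∀ {x} → x ≉ 0# → x ⁻¹ * x ≈ 1#
  inverseˡ {x} x≉0 = trans (*-comm (x ⁻¹) x) (inverseʳ x x≉0)

  x≉y⇒x-y≉0 : ∀ {x y} → x ≉ y → x - y ≉ 0#
  x≉y⇒x-y≉0 x≉y x-y≈0 = x≉y (x∙y⁻¹≈ε⇒x≈y _ _ x-y≈0)

  *-≉0 : ∀ {x y} → x ≉ 0# → y ≉ 0# → x * y ≉ 0#
  *-≉0 {x} {y} x≉0 y≉0 xy≈0 = y≉0 (begin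
    y               ≈⟨ *-identityˡ y ⟨
    1# * y          ≈⟨ *-congʳ (inverseˡ x≉0) ⟨
    x ⁻¹ * x * y    ≈⟨ *-assoc (x ⁻¹) x y ⟩
    x ⁻¹ * (x * y)  ≈⟨ *-congˡ xy≈0 ⟩
    x ⁻¹ * 0#       ≈⟨ zeroʳ (x ⁻¹) ⟩
    0#              ∎)

  ⁻¹-≉0 : ∀ {x} → x ≉ 0# → x ⁻¹ ≉ 0#
  ⁻¹-≉0 {x} x≉0 x⁻¹≈0 = 0≉1 (begin
    0#        ≈⟨ zeroʳ x ⟨
    x * 0#    ≈⟨ *-congˡ x⁻¹≈0 ⟨
    x * x ⁻¹  ≈⟨ inverseʳ x x≉0 ⟩
    1#        ∎)

  ⁻¹-unique : ∀ {x y} → x * y ≈ 1# → y ≈ x ⁻¹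
  ⁻¹-unique {x} {y} xy≈1 = begin
    y               ≈⟨ *-identityˡ y ⟨
    1# * y          ≈⟨ *-congʳ (inverseˡ x≉0) ⟨
    x ⁻¹ * x * y    ≈⟨ *-assoc (x ⁻¹) x y ⟩
    x ⁻¹ * (x * y)  ≈⟨ *-congˡ xy≈1 ⟩
    x ⁻¹ * 1#       ≈⟨ *-identityʳ (x ⁻¹) ⟩
    x ⁻¹            ∎
    where
    x≉0 : x ≉ 0#
    x≉0 x≈0 = 0≉1 (trans (sym (trans (*-congʳ x≈0) (zeroˡ y))) xy≈1)

  1⁻¹≈1 : 1# ⁻¹ ≈ 1#
  1⁻¹≈1 = sym (⁻¹-unique (*-identityˡ 1#))

  ⁻¹-involutive : ∀ {x} → x ≉ 0# → x ⁻¹ ⁻¹ ≈ x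
  ⁻¹-involutive x≉0 = sym (⁻¹-unique (inverseˡ x≉0))

  ⁻¹-distrib-* : ∀ {x y} → x ≉ 0# → y ≉ 0# → (x * y) ⁻¹ ≈ x ⁻¹ * y ⁻¹
  ⁻¹-distrib-* {x} {y} x≉0 y≉0 = sym (⁻¹-unique (begin
    x * y * (x ⁻¹ * y ⁻¹)
      ≈⟨ solve 4 (λ x y x′ y′ → (x ⊕ y) ⊕ (x′ ⊕ y′) ⊜ (x ⊕ x′) ⊕ (y ⊕ y′)) refl x y (x ⁻¹) (y ⁻¹) ⟩
    x * x ⁻¹ * (y * y ⁻¹)   ≈⟨ *-cong (inverseʳ x x≉0) (inverseʳ y y≉0) ⟩
    1# * 1#                 ≈⟨ *-identityˡ 1# ⟩
    1#                      ∎))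

  [x*y]⁻¹*x≈y⁻¹ : ∀ {x y} → x ≉ 0# → y ≉ 0# → (x * y) ⁻¹ * x ≈ y ⁻¹
  [x*y]⁻¹*x≈y⁻¹ {x} {y} x≉0 y≉0 = begin
    (x * y) ⁻¹ * x        ≈⟨ *-congʳ (⁻¹-distrib-* x≉0 y≉0) ⟩
    x ⁻¹ * y ⁻¹ * x       ≈⟨ solve 3 (λ x′ y′ x → (x′ ⊕ y′) ⊕ x ⊜ y′ ⊕ (x′ ⊕ x)) refl (x ⁻¹) (y ⁻¹) x ⟩
    y ⁻¹ * (x ⁻¹ * x)     ≈⟨ *-congˡ (inverseˡ x≉0) ⟩
    y ⁻¹ * 1#             ≈⟨ *-identityʳ (y ⁻¹) ⟩
    y ⁻¹                  ∎

  x⁻¹/y⁻¹≈y/x : ∀ {x y} → y ≉ 0# → x ⁻¹ / y ⁻¹ ≈ y / x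
  x⁻¹/y⁻¹≈y/x {x} {y} y≉0 = trans (*-congˡ (⁻¹-involutive y≉0)) (*-comm (x ⁻¹) y)

  x/y≈[x*z]/[y*z] : ∀ {x y z} → y ≉ 0# → z ≉ 0# → x / y ≈ (x * z) / (y * z)
  x/y≈[x*z]/[y*z] {x} {y} {z} y≉0 z≉0 = sym (begin
    x * z * (y * z) ⁻¹      ≈⟨ *-congˡ (⁻¹-distrib-* y≉0 z≉0) ⟩
    x * z * (y ⁻¹ * z ⁻¹)
      ≈⟨ solve 4 (λ x z y′ z′ → (x ⊕ z) ⊕ (y′ ⊕ z′) ⊜ (x ⊕ y′) ⊕ (z ⊕ z′)) refl x z (y ⁻¹) (z ⁻¹) ⟩
    x * y ⁻¹ * (z * z ⁻¹)   ≈⟨ *-congˡ (inverseʳ z z≉0) ⟩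
    x * y ⁻¹ * 1#           ≈⟨ *-identityʳ (x * y ⁻¹) ⟩
    x * y ⁻¹                ∎)

  double-ratio-step : ∀ {a b c d u v x y U V X Y} →
    v ≉ 0# → y ≉ 0# → a - d ≉ 0# → b - c ≉ 0# →
    U ≈ u * (a - c) → V ≈ v * (a - d) → X ≈ x * (b - d) → Y ≈ y * (b - c) →
    (a - b) * (c - d) * (u / V) * (x / Y) ≈ (U / V) * (X / Y) - (u / v) * (x / y)
  double-ratio-step {a} {b} {c} {d} {u} {v} {x} {y} {U} {V} {X} {Y}
                    v≉0 y≉0 β≉0 δ≉0 U≈uα V≈vβ X≈xγ Y≈yδ = sym (begin
    (U / V) * (X / Y) - (u / v) * (x / y)
      ≈⟨ +-cong (*-cong (*-congʳ U≈uα) (*-congʳ X≈xγ)) (-‿cong (*-cong u/v≈uβ/V x/y≈xδ/Y)) ⟩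
    (u * α) / V * ((x * γ) / Y) - (u * β) / V * ((x * δ) / Y)
      ≈⟨ +-cong (pull u α V x γ Y) (-‿cong (pull u β V x δ Y)) ⟩
    α * γ * M - β * δ * M                ≈⟨ [y-z]x≈yx-zx M (α * γ) (β * δ) ⟨
    (α * γ - β * δ) * M                  ≈⟨ *-congʳ ([a-c][b-d]-[a-d][b-c]≈[a-b][c-d] a b c d) ⟩
    (a - b) * (c - d) * M                ≈⟨ *-assoc ((a - b) * (c - d)) (u / V) (x / Y) ⟨
    (a - b) * (c - d) * (u / V) * (x / Y) ∎)
    where
    α = a - c
    β = a - d
    γ = b - d
    δ = b - c
    M = (u / V) * (x / Y)
    pull : ∀ p s q r t w → (p * s) / q * ((r * t) / w) ≈ s * t * (p / q * (r / w))
    pull p s q r t w = solve 6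
      (λ p s q′ r t w′ → ((p ⊕ s) ⊕ q′) ⊕ ((r ⊕ t) ⊕ w′) ⊜ (s ⊕ t) ⊕ ((p ⊕ q′) ⊕ (r ⊕ w′)))
      refl p s (q ⁻¹) r t (w ⁻¹)
    u/v≈uβ/V : u / v ≈ (u * β) / V
    u/v≈uβ/V = trans (x/y≈[x*z]/[y*z] v≉0 β≉0) (*-congˡ (⁻¹-cong (sym V≈vβ)))
    x/y≈xδ/Y : x / y ≈ (x * δ) / Y
    x/y≈xδ/Y = trans (x/y≈[x*z]/[y*z] y≉0 δ≉0) (*-congˡ (⁻¹-cong (sym Y≈yδ)))

module Telescoping {c ℓ} (F : Field c ℓ) where
  open Field F
  open import Relation.Binary.Reasoning.Setoid setoid
  open CommutativeRingProperties commutativeRing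

  sumUp-telescoping : ∀ (f g : ℤ → Carrier) k l →
    (∀ i → i ℕ.< l → f (k Z.+ + i) ≈ g (k Z.+ + i Z.+ + 1) - g (k Z.+ + i)) →
    sumUp f k l ≈ g (k Z.+ + l) - g k
  sumUp-telescoping f g k zero _ rewrite ZP.+-identityʳ k = sym (-‿inverseʳ (g k))
  sumUp-telescoping f g k (suc l) step = begin
    f k + sumUp f k′ l                        ≈⟨ +-cong first rest ⟩
    (g k′ - g k) + (g (k′ Z.+ + l) - g k′)    ≈⟨ +-comm (g k′ - g k) _ ⟩
    (g (k′ Z.+ + l) - g k′) + (g k′ - g k)    ≈⟨ [x-y]+[y-z]≈x-z (g (k′ Z.+ + l)) (g k′) (g k) ⟩
    g (k′ Z.+ + l) - g k                      ≡⟨ ≡.cong (λ j → g j - g k) (ZP.+-assoc k (+ 1) (+ l)) ⟩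
    g (k Z.+ + suc l) - g k                   ∎
    where
    k′ = k Z.+ + 1
    Step : ℤ → Set ℓ
    Step j = f j ≈ g (j Z.+ + 1) - g j
    first : Step k
    first = ≡.subst Step (ZP.+-identityʳ k) (step 0 (s≤s z≤n))
    rest : sumUp f k′ l ≈ g (k′ Z.+ + l) - g k′
    rest = sumUp-telescoping f g k′ l λ i i<l →
      ≡.subst Step (≡.sym (ZP.+-assoc k (+ 1) (+ i))) (step (suc i) (s≤s i<l))

module Products {c ℓ} (F : Field c ℓ) where
  open Field F
  open FieldProperties F
  open import Relation.Binary.Reasoning.Setoid setoid

  prodUp-snoc : ∀ A k l → prodUp A k (suc l) ≈ prodUp A k l * A (k Z.+ + l)
  prodUp-snoc A k zero = begin
    A k * 1#              ≈⟨ *-comm (A k) 1# ⟩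
    1# * A k              ≡⟨ ≡.cong (λ j → 1# * A j) (ZP.+-identityʳ k) ⟨
    1# * A (k Z.+ + 0)    ∎
  prodUp-snoc A k (suc l) = begin
    A k * prodUp A k′ (suc l)              ≈⟨ *-congˡ (prodUp-snoc A k′ l) ⟩
    A k * (prodUp A k′ l * A (k′ Z.+ + l)) ≈⟨ *-assoc (A k) _ _ ⟨
    A k * prodUp A k′ l * A (k′ Z.+ + l)
      ≡⟨ ≡.cong (λ j → A k * prodUp A k′ l * A j) (ZP.+-assoc k (+ 1) (+ l)) ⟩
    A k * prodUp A k′ l * A (k Z.+ + suc l) ∎
    where k′ = k Z.+ + 1

  prodUp-≉0 : ∀ A k l → (∀ i → i ℕ.< l → A (k Z.+ + i) ≉ 0#) → prodUp A k l ≉ 0#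
  prodUp-≉0 A k zero    _   = 1≉0
  prodUp-≉0 A k (suc l) A≉0 = *-≉0 (≡.subst (λ j → A j ≉ 0#) (ZP.+-identityʳ k) (A≉0 0 (s≤s z≤n)))
    (prodUp-≉0 A (k Z.+ + 1) l λ i i<l →
      ≡.subst (λ j → A j ≉ 0#) (≡.sym (ZP.+-assoc k (+ 1) (+ i))) (A≉0 (suc i) (s≤s i<l)))

  prod≡prodUp : ∀ A k m {l} → m Z.- k Z.+ + 1 ≡ + l → prod A k m ≡ prodUp A k l
  prod≡prodUp A k m eq with m Z.- k Z.+ + 1 | eq
  ... | _ | ≡.refl = ≡.refl

  prod≡prodUp⁻¹ : ∀ A k m {l} → m Z.- k Z.+ + 1 ≡ -[1+ l ] → prod A k m ≡ prodUp A (m Z.+ + 1) (suc l) ⁻¹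
  prod≡prodUp⁻¹ A k m eq with m Z.- k Z.+ + 1 | eq
  ... | _ | ≡.refl = ≡.refl

  prod-from-1-+ : ∀ A l → prod A (+ 1) (+ l) ≡ prodUp A (+ 1) l
  prod-from-1-+ A l = prod≡prodUp A (+ 1) (+ l) (i-1+1≡i (+ l))

  prod-from-1-neg : ∀ A l → prod A (+ 1) -[1+ l ] ≡ prodUp A (Z.- (+ l)) (suc l) ⁻¹
  prod-from-1-neg A l = ≡.trans (prod≡prodUp⁻¹ A (+ 1) -[1+ l ] (i-1+1≡i -[1+ l ]))
                                (≡.cong (λ k → prodUp A k (suc l) ⁻¹) (-[1+l]+1≡-l l))

  prod-to-0 : ∀ A l → prod A (Z.- (+ l)) (+ 0) ≡ prodUp A (Z.- (+ l)) (suc l)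
  prod-to-0 A l = prod≡prodUp A (Z.- (+ l)) (+ 0) (0-[-l]+1≡1+l l)

  prodUp-from-neg-suc : ∀ A l →
    prodUp A (Z.- (+ suc l)) (suc (suc l)) ≡ A -[1+ l ] * prodUp A (Z.- (+ l)) (suc l)
  prodUp-from-neg-suc A l = ≡.cong (λ k → A -[1+ l ] * prodUp A k (suc l)) (-[1+l]+1≡-l l)

  prod-from-1-neg-pred : ∀ A l →
    prod A (+ 1) (-[1+ l ] Z.- + 1) ≡ (A -[1+ l ] * prodUp A (Z.- (+ l)) (suc l)) ⁻¹
  prod-from-1-neg-pred A l = ≡.trans (≡.cong (prod A (+ 1)) (-l-1≡-[1+l] (suc l)))
    (≡.trans (prod-from-1-neg A (suc l)) (≡.cong _⁻¹ (prodUp-from-neg-suc A l)))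

  module PartialProducts (A : ℤ → Carrier) (n m : ℕ)
                         (A≉0 : ∀ j → Z.- (+ n) Z.≤ j → j Z.≤ + m → A j ≉ 0#) where

    prodUp-from-neg-≉0 : ∀ {l} → l ℕ.≤ n → prodUp A (Z.- (+ l)) (suc l) ≉ 0#
    prodUp-from-neg-≉0 {zero}  _    = *-≉0 (A≉0 (+ 0) ZP.neg-≤-pos (+≤+ z≤n)) 1≉0
    prodUp-from-neg-≉0 {suc l} l<n  = ≡.subst (_≉ 0#) (≡.sym (prodUp-from-neg-suc A l))
      (*-≉0 (A≉0 -[1+ l ] (ZP.neg-mono-≤ (+≤+ l<n)) Z.-≤+) (prodUp-from-neg-≉0 (ℕ.<⇒≤ l<n)))

    prodUp-from-1-≉0 : ∀ {l} → l ℕ.≤ m → prodUp A (+ 1) l ≉ 0#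
    prodUp-from-1-≉0 l≤m = prodUp-≉0 A (+ 1) _ λ i i<l →
      A≉0 (+ suc i) ZP.neg-≤-pos (+≤+ (ℕ.≤-trans i<l l≤m))

    prod-step : ∀ k → Z.- (+ n) Z.≤ k → k Z.≤ + m → prod A (+ 1) k ≈ prod A (+ 1) (k Z.- + 1) * A k
    prod-step (+ zero) _ _ = sym (trans ([x*y]⁻¹*x≈y⁻¹ (A≉0 (+ 0) ZP.neg-≤-pos (+≤+ z≤n)) 1≉0) 1⁻¹≈1)
    prod-step (+ suc i) _ _ rewrite prod-from-1-+ A (suc i) | prod-from-1-+ A i = prodUp-snoc A (+ 1) i
    prod-step -[1+ i ] lo _ rewrite prod-from-1-neg A i | prod-from-1-neg-pred A i =
      sym ([x*y]⁻¹*x≈y⁻¹ (A≉0 -[1+ i ] lo Z.-≤+) (prodUp-from-neg-≉0 (ℕ.<⇒≤ (-n≤-[1+i]⇒i<n lo))))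

    prod-pred-≉0 : ∀ k → Z.- (+ n) Z.≤ k → k Z.≤ + m → prod A (+ 1) (k Z.- + 1) ≉ 0#
    prod-pred-≉0 (+ zero)  _ _  = ⁻¹-≉0 (prodUp-from-neg-≉0 z≤n)
    prod-pred-≉0 (+ suc i) _ (+≤+ i<m) =
      ≡.subst (_≉ 0#) (≡.sym (prod-from-1-+ A i)) (prodUp-from-1-≉0 (ℕ.<⇒≤ i<m))
    prod-pred-≉0 -[1+ i ]  lo _ = ≡.subst (_≉ 0#) (≡.sym (prod-from-1-neg-pred A i))
      (⁻¹-≉0 (*-≉0 (A≉0 -[1+ i ] lo Z.-≤+) (prodUp-from-neg-≉0 (ℕ.<⇒≤ (-n≤-[1+i]⇒i<n lo)))))

module _ {c ℓ} (F : Field c ℓ) where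
  open Field F
  open FieldProperties F
  open Products F

  module FourSequences (a b c d : ℤ → Carrier) (m n : ℕ)
           (H : ∀ j → Z.- (+ n) Z.≤ j → j Z.≤ + m →
                  (¬ (a j ≈ c j)) × (¬ (a j ≈ d j)) × (¬ (b j ≈ c j)) × (¬ (b j ≈ d j))) where

    α β γ δ : ℤ → Carrier
    α j = a j - c j
    β j = a j - d j
    γ j = b j - d j
    δ j = b j - c j

    α≉0 : ∀ j → Z.- (+ n) Z.≤ j → j Z.≤ + m → α j ≉ 0#
    α≉0 j lo hi = x≉y⇒x-y≉0 (proj₁ (H j lo hi))
    β≉0 : ∀ j → Z.- (+ n) Z.≤ j → j Z.≤ + m → β j ≉ 0#
    β≉0 j lo hi = x≉y⇒x-y≉0 (proj₁ (proj₂ (H j lo hi)))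
    γ≉0 : ∀ j → Z.- (+ n) Z.≤ j → j Z.≤ + m → γ j ≉ 0#
    γ≉0 j lo hi = x≉y⇒x-y≉0 (proj₂ (proj₂ (proj₂ (H j lo hi))))
    δ≉0 : ∀ j → Z.- (+ n) Z.≤ j → j Z.≤ + m → δ j ≉ 0#
    δ≉0 j lo hi = x≉y⇒x-y≉0 (proj₁ (proj₂ (proj₂ (H j lo hi))))

    module α = PartialProducts α n m α≉0
    module β = PartialProducts β n m β≉0
    module γ = PartialProducts γ n m γ≉0
    module δ = PartialProducts δ n m δ≉0

    ratio : ℤ → Carrier
    ratio k = (prod α (+ 1) k / prod β (+ 1) k) * (prod γ (+ 1) k / prod δ (+ 1) k)

    summand : ℤ → Carrier
    summand k = (a k - b k) * (c k - d k)
              * (prod α (+ 1) (k Z.- + 1) / prod β (+ 1) k)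
              * (prod γ (+ 1) (k Z.- + 1) / prod δ (+ 1) k)

    summand≈ratio-difference : ∀ k → Z.- (+ n) Z.≤ k → k Z.≤ + m →
      summand k ≈ ratio k - ratio (k Z.- + 1)
    summand≈ratio-difference k lo hi =
      double-ratio-step (β.prod-pred-≉0 k lo hi) (δ.prod-pred-≉0 k lo hi)
        (β≉0 k lo hi) (δ≉0 k lo hi)
        (α.prod-step k lo hi) (β.prod-step k lo hi) (γ.prod-step k lo hi) (δ.prod-step k lo hi)

    ratio-below : ratio -[1+ n ] ≈
      (prod β (Z.- (+ n)) (+ 0) / prod α (Z.- (+ n)) (+ 0)) * (prod δ (Z.- (+ n)) (+ 0) / prod γ (Z.- (+ n)) (+ 0))
    ratio-below
      rewrite prod-from-1-neg α n | prod-from-1-neg β n | prod-from-1-neg γ n | prod-from-1-neg δ n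
            | prod-to-0 α n | prod-to-0 β n | prod-to-0 γ n | prod-to-0 δ n
      = *-cong (x⁻¹/y⁻¹≈y/x (β.prodUp-from-neg-≉0 ℕ.≤-refl))
               (x⁻¹/y⁻¹≈y/x (δ.prodUp-from-neg-≉0 ℕ.≤-refl))

    summand-telescopes : ∀ i → i ℕ.< n ℕ.+ m ℕ.+ 1 →
      summand (Z.- (+ n) Z.+ + i) ≈ ratio (Z.- (+ n) Z.+ + i Z.+ + 1 Z.- + 1) - ratio (Z.- (+ n) Z.+ + i Z.- + 1)
    summand-telescopes i i<l = ≡.subst (λ k → summand j ≈ ratio k - ratio (j Z.- + 1)) (≡.sym (i+1-1≡i j))
                                 (summand≈ratio-difference j lo hi)
      where
      j = Z.- (+ n) Z.+ + i
      lo : Z.- (+ n) Z.≤ j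
      lo = ZP.i≤i+j (Z.- (+ n)) (+ i)
      i≤n+m : i ℕ.≤ n ℕ.+ m
      i≤n+m = ℕ.m<1+n⇒m≤n (≡.subst (i ℕ.<_) (ℕ.+-comm (n ℕ.+ m) 1) i<l)
      hi : j Z.≤ + m
      hi = ZP.≤-trans (ZP.+-monoʳ-≤ (Z.- (+ n)) (+≤+ i≤n+m)) (ZP.≤-reflexive (-n+[n+m]≡m n m))

corollary3p4 : ∀ {c ℓ} (F : Field c ℓ) → let open Field F in
    (a b c d : ℤ → Carrier) (m n : ℕ) →
    (∀ j → Z.- (+ n) Z.≤ j → j Z.≤ + m →
       (¬ (a j ≈ c j)) × (¬ (a j ≈ d j)) × (¬ (b j ≈ c j)) × (¬ (b j ≈ d j))) →
    sumUp (λ k → (a k - b k) * (c k - d k)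
                 * (prod (λ j → a j - c j) (+ 1) (k Z.- + 1) / prod (λ j → a j - d j) (+ 1) k)
                 * (prod (λ j → b j - d j) (+ 1) (k Z.- + 1) / prod (λ j → b j - c j) (+ 1) k))
          (Z.- (+ n)) (Data.Nat._+_ (Data.Nat._+_ n m) 1)
    ≈ (prod (λ j → a j - c j) (+ 1) (+ m) / prod (λ j → a j - d j) (+ 1) (+ m))
      * (prod (λ j → b j - d j) (+ 1) (+ m) / prod (λ j → b j - c j) (+ 1) (+ m))
      - (prod (λ j → a j - d j) (Z.- (+ n)) (+ 0) / prod (λ j → a j - c j) (Z.- (+ n)) (+ 0))
      * (prod (λ j → b j - c j) (Z.- (+ n)) (+ 0) / prod (λ j → b j - d j) (Z.- (+ n)) (+ 0))
corollary3p4 F a b c d m n H = begin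
  sumUp summand (Z.- (+ n)) (n ℕ.+ m ℕ.+ 1)
    ≈⟨ sumUp-telescoping summand (λ k → ratio (k Z.- + 1)) (Z.- (+ n)) (n ℕ.+ m ℕ.+ 1) summand-telescopes ⟩
  ratio (Z.- (+ n) Z.+ + (n ℕ.+ m ℕ.+ 1) Z.- + 1) - ratio (Z.- (+ n) Z.- + 1)
    ≡⟨ ≡.cong₂ (λ k l → ratio k - ratio l) (-n+[n+m+1]-1≡m n m) (-l-1≡-[1+l] n) ⟩
  ratio (+ m) - ratio -[1+ n ]
    ≈⟨ +-congˡ (-‿cong ratio-below) ⟩
  ratio (+ m) - (β₀ / α₀) * (δ₀ / γ₀) ∎
  where
  open Field F
  open Telescoping F
  open FourSequences F a b c d m n H
  open SetoidReasoning setoid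
  α₀ = prod α (Z.- (+ n)) (+ 0)
  β₀ = prod β (Z.- (+ n)) (+ 0)
  γ₀ = prod γ (Z.- (+ n)) (+ 0)
  δ₀ = prod δ (Z.- (+ n)) (+ 0)
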